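{- Let $p,q$ be integers with $2q\le p\le \frac{5}{2}q$, and let $\widehat{G}^*$ be the signed graph obtained from $(K_3,-)$ on vertices $y_1,y_2,y_3$ by identifying each edge $y_iy_j$ with the edge $uv$ of a distinct copy of $\widehat{W}^*$, embedded in the plane so that the outer face is the negative triangle $y_1y_2y_3$. Then in every balanced $(p,q)$-coloring of $\widehat{G}^*$ at most $p-3q+21m_{p,q}$ colors miss the outer face.
   Context: A signed graph is a graph with a signature assigning $+$ or $-$ to each edge; a cycle is negative if it has an odd number of negative edges; a vertex set is balanced if it induces no negative cycle. $(K_3,-)$ is the triangle with all edges negative. A balanced $(p,q)$-coloring assigns to each vertex a set of $q$ colors from $\{1,\dots,p\}$ so that each color class is balanced. A color misses a set of vertices if no vertex of the set receives it. $m_{p,q}$ is the smallest integer $m$ such that there exists a planar signed simple graph $\widehat{T}$, embedded with outer face a negative triangle, such that in every balanced $(p,q)$-coloring of $\widehat{T}$ at most $m$ colors miss the outer face; $\widehat{T}$ denotes such a graph attaining $m_{p,q}$. Completing a negative triangle with a copy of $\widehat{T}$ means inserting a copy of $\widehat{T}$ into the face bounded by the triangle, identifying its outer triangle with it (switching the copy if needed so signs agree). $\widehat{W}$ has vertices $u,v,w,z,t,x_1,\dots,x_5$ and edges $wx_i$ ($1\le i\le5$), $x_1x_2,x_2x_3,x_3x_4,x_4x_5,x_5x_1$, $zx_2,zx_3,zu,zv$, $tx_4,tx_5,tu,tv$, $ux_1,ux_2,ux_5,uv$, $vx_3,vx_4$; the edges $ux_2$ and $vx_4$ are positive and all others negative.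 $\widehat{W}'$ is obtained from $\widehat{W}$ by adding vertices $a_1,a_2,a_3$ (inside the face $ux_1x_2$) with negative edges $a_1a_2,a_2a_3,a_1a_3,a_1x_1,a_1x_2,a_2u$ and positive edges $a_2x_2,a_3u,a_3x_1$, and vertices $b_1,b_2,b_3$ (inside the face $vx_3x_4$) with negative edges $b_1b_2,b_2b_3,b_1b_3,b_1x_3,b_1x_4,b_2v$ and positive edges $b_2x_4,b_3v,b_3x_3$. $\widehat{W}^*$ is obtained from $\widehat{W}'$ by completing each of the seven negative triangles $wx_1x_2$, $wx_1x_5$, $wx_3x_4$, $zx_2x_3$, $tx_4x_5$, $a_1a_2a_3$, $b_1b_2b_3$ with a copy of $\widehat{T}$. -}

module Defs where

open import Data.Nat using (ℕ; zero; suc; _+_; _%_)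
open import Data.Bool using (Bool; true; false; _xor_; not)
open import Data.Fin using (Fin; zero; suc; inject₁; fromℕ)
open import Data.Fin.Subset using (Subset; ∣_∣; _∈_; ∁; _∪_)
open import Data.Product using (Σ; Σ-syntax; _×_; _,_)
open import Data.Sum using (_⊎_; inj₁; inj₂)
open import Data.List using (List; []; _∷_)
open import Data.List.Membership.Propositional using () renaming (_∈_ to _∈ₗ_)
open import Data.Vec using (Vec; []; _∷_; lookup)
open import Function.Definitions using (Injective)
open import Relation.Binary.PropositionalEquality using (_≡_; _≢_)
open import Relation.Nullary using (¬_)

-- A signed graph: a vertex type and a signed edge relation.
-- Edge x y s : x and y are adjacent by an edge of sign s
-- (s = true means the edge is NEGATIVE, s = false means POSITIVE).
record SignedGraph : Set₁ where
  field
    V    : Set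
    Edge : V → V → Bool → Set

countTrue : ∀ {n} → (Fin n → Bool) → ℕ
countTrue {zero}  f = 0
countTrue {suc n} f with f zero
... | true  = suc (countTrue (λ i → f (suc i)))
... | false = countTrue (λ i → f (suc i))

module _ (G : SignedGraph) where
  open SignedGraph G

  record CycleIn (X : V → Set) : Set where
    field
      len      : ℕ
      vtx      : Fin (3 + len) → V
      sgn      : Fin (3 + len) → Bool
      distinct : Injective _≡_ _≡_ vtx
      inX      : ∀ i → X (vtx i)
      step     : ∀ (i : Fin (2 + len)) →
                 Edge (vtx (inject₁ i)) (vtx (suc i)) (sgn (inject₁ i))
      close    : Edge (vtx (fromℕ (2 + len))) (vtx zero) (sgn (fromℕ (2 + len)))

  NegativeCycle : ∀ {X} → CycleIn X → Set
  NegativeCycle C = countTrue (CycleIn.sgn C) % 2 ≡ 1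

  Balanced : (V → Set) → Set
  Balanced X = ¬ (Σ[ C ∈ CycleIn X ] NegativeCycle C)

  BalancedColoring : (p q : ℕ) → (V → Subset p) → Set
  BalancedColoring p q c =
    (∀ x → ∣ c x ∣ ≡ q) × (∀ (col : Fin p) → Balanced (λ x → col ∈ c x))

missing : ∀ {A : Set} {p} → (A → Subset p) → A → A → A → ℕ
missing c a b d = ∣ ∁ (c a ∪ c b ∪ c d) ∣

-- The graph T̂ : a finite simple signed graph on Fin (3 + k) whose
-- (outer) triangle is 0,1,2 and is negative.

t0 t1 t2 : ∀ {k} → Fin (3 + k)
t0 = zero
t1 = suc zero
t2 = suc (suc zero)

record OuterTriangleGraph (k : ℕ) : Set where
  field
    adj      : Fin (3 + k) → Fin (3 + k) → Bool
    neg      : Fin (3 + k) → Fin (3 + k) → Bool   -- true = negative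
    adj-sym  : ∀ a b → adj a b ≡ adj b a
    neg-sym  : ∀ a b → neg a b ≡ neg b a
    adj-irr  : ∀ a → adj a a ≡ false
    outer01  : adj t0 t1 ≡ true
    outer12  : adj t1 t2 ≡ true
    outer20  : adj t2 t0 ≡ true
    outerNeg : (neg t0 t1 xor neg t1 t2) xor neg t2 t0 ≡ true

  asSigned : SignedGraph
  asSigned = record { V = Fin (3 + k)
                    ; Edge = λ a b s → adj a b ≡ true × neg a b ≡ s }

  -- switching of the copy so that its outer triangle becomes all negative
  -- (all the triangles it is inserted into are all-negative)
  σ : Fin (3 + k) → Bool
  σ zero                = false
  σ (suc zero)          = not (neg t0 t1)
  σ (suc (suc zero))    = not (neg t0 t2)
  σ (suc (suc (suc _))) = false

  swNeg : Fin (3 + k) → Fin (3 + k) → Bool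
  swNeg a b = (neg a b xor σ a) xor σ b

data WI : Set where
  vw vz vt vx1 vx2 vx3 vx4 vx5 va1 va2 va3 vb1 vb2 vb3 : WI

data WV : Set where
  vu vv : WV
  ι     : WI → WV

-- edges of Ŵ' (each listed once), with sign (true = negative)
W'edges : List (WV × WV × Bool)
W'edges =
    (ι vw , ι vx1 , true) ∷ (ι vw , ι vx2 , true) ∷ (ι vw , ι vx3 , true)
  ∷ (ι vw , ι vx4 , true) ∷ (ι vw , ι vx5 , true)
  ∷ (ι vx1 , ι vx2 , true) ∷ (ι vx2 , ι vx3 , true) ∷ (ι vx3 , ι vx4 , true)
  ∷ (ι vx4 , ι vx5 , true) ∷ (ι vx5 , ι vx1 , true)
  ∷ (ι vz , ι vx2 , true) ∷ (ι vz , ι vx3 , true) ∷ (ι vz , vu , true) ∷ (ι vz , vv , true)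
  ∷ (ι vt , ι vx4 , true) ∷ (ι vt , ι vx5 , true) ∷ (ι vt , vu , true) ∷ (ι vt , vv , true)
  ∷ (vu , ι vx1 , true) ∷ (vu , ι vx2 , false) ∷ (vu , ι vx5 , true) ∷ (vu , vv , true)
  ∷ (vv , ι vx3 , true) ∷ (vv , ι vx4 , false)
  ∷ (ι va1 , ι va2 , true) ∷ (ι va2 , ι va3 , true) ∷ (ι va1 , ι va3 , true)
  ∷ (ι va1 , ι vx1 , true) ∷ (ι va1 , ι vx2 , true) ∷ (ι va2 , vu , true)
  ∷ (ι va2 , ι vx2 , false) ∷ (ι va3 , vu , false) ∷ (ι va3 , ι vx1 , false)
  ∷ (ι vb1 , ι vb2 , true) ∷ (ι vb2 , ι vb3 , true) ∷ (ι vb1 , ι vb3 , true)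
  ∷ (ι vb1 , ι vx3 , true) ∷ (ι vb1 , ι vx4 , true) ∷ (ι vb2 , vv , true)
  ∷ (ι vb2 , ι vx4 , false) ∷ (ι vb3 , vv , false) ∷ (ι vb3 , ι vx3 , false)
  ∷ []

W'Edge : WV → WV → Bool → Set
W'Edge a b s = ((a , b , s) ∈ₗ W'edges) ⊎ ((b , a , s) ∈ₗ W'edges)

-- the seven negative triangles to be completed with copies of T̂
-- (the copy's vertices 0,1,2 are identified with the listed vertices, in order)
triangles : Vec (WV × WV × WV) 7
triangles =
    (ι vw , ι vx1 , ι vx2) ∷ (ι vw , ι vx1 , ι vx5) ∷ (ι vw , ι vx3 , ι vx4)
  ∷ (ι vz , ι vx2 , ι vx3) ∷ (ι vt , ι vx4 , ι vx5) ∷ (ι va1 , ι va2 , ι va3)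
  ∷ (ι vb1 , ι vb2 , ι vb3) ∷ []

-- Ŵ* = Ŵ' with the seven triangles completed by copies of T̂

W*V : ℕ → Set
W*V k = WV ⊎ (Fin 7 × Fin k)

embT : ∀ {k} → Fin 7 → Fin (3 + k) → W*V k
embT j zero = inj₁ (Data.Product.proj₁ (lookup triangles j))
embT j (suc zero) = inj₁ (Data.Product.proj₁ (Data.Product.proj₂ (lookup triangles j)))
embT j (suc (suc zero)) = inj₁ (Data.Product.proj₂ (Data.Product.proj₂ (lookup triangles j)))
embT j (suc (suc (suc r))) = inj₂ (j , r)

W*Edge : ∀ {k} → OuterTriangleGraph k → W*V k → W*V k → Bool → Set
W*Edge {k} T x y s =
    (Σ[ a ∈ WV ] Σ[ b ∈ WV ] W'Edge a b s × inj₁ a ≡ x × inj₁ b ≡ y)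
  ⊎ (Σ[ j ∈ Fin 7 ] Σ[ a ∈ Fin (3 + k) ] Σ[ b ∈ Fin (3 + k) ]
       OuterTriangleGraph.adj T a b ≡ true × OuterTriangleGraph.swNeg T a b ≡ s
       × embT j a ≡ x × embT j b ≡ y)

-- Ĝ* : (K₃,-) on y₀ y₁ y₂, the edge y_i y_{i+1} identified with the edge
-- u v of the i-th copy of Ŵ* (u ↦ y_i, v ↦ y_{i+1}, indices mod 3)

nxt : Fin 3 → Fin 3
nxt zero = suc zero
nxt (suc zero) = suc (suc zero)
nxt (suc (suc zero)) = zero

GV : ℕ → Set
GV k = Fin 3 ⊎ (Fin 3 × (WI ⊎ (Fin 7 × Fin k)))

embW : ∀ {k} → Fin 3 → W*V k → GV k
embW i (inj₁ vu) = inj₁ i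
embW i (inj₁ vv) = inj₁ (nxt i)
embW i (inj₁ (ι a)) = inj₂ (i , inj₁ a)
embW i (inj₂ r) = inj₂ (i , inj₂ r)

G*Edge : ∀ {k} → OuterTriangleGraph k → GV k → GV k → Bool → Set
G*Edge {k} T x y s =
    (Σ[ i ∈ Fin 3 ] Σ[ j ∈ Fin 3 ] i ≢ j × s ≡ true × inj₁ i ≡ x × inj₁ j ≡ y)
  ⊎ (Σ[ i ∈ Fin 3 ] Σ[ a ∈ W*V k ] Σ[ b ∈ W*V k ]
       W*Edge T a b s × embW i a ≡ x × embW i b ≡ y)

G* : ∀ {k} → OuterTriangleGraph k → SignedGraph
G* {k} T = record { V = GV k ; Edge = G*Edge T }

y₀ y₁ y₂ : ∀ {k} → GV k
y₀ = inj₁ zero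
y₁ = inj₁ (suc zero)
y₂ = inj₁ (suc (suc zero))

-- A color lying on two consecutive outer vertices y_i, y_(i+1) lies on u and v of the i-th
-- copy of W*. Balance of its color class forces it to miss the outer triangle of one of the
-- seven copies of T in that copy: otherwise one of fifteen short negative cycles of W' would
-- be monochromatic. Switching preserves the sign of every cycle, so the coloring restricted
-- to a copy of T is a balanced (p,q)-coloring of T, and at most m colors miss its outer
-- triangle. Hence y_i and y_(i+1) share at most 7m colors, and inclusion-exclusion for
-- c(y_0), c(y_1), c(y_2) gives missing + 3q <= p + (colors shared by consecutive y_i) <= p + 21m.
module Submission where

open import Defs
open import Algebra.Bundles using (CommutativeRing)
open import Data.Bool using (Bool; true; false; _xor_; not; if_then_else_)
import Data.Bool.Properties as Bool
open import Data.Bool.Properties using (xor-∧-commutativeRing; xor-assoc; xor-same; xor-identityʳ; xor-comm)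
open import Algebra.Properties.CommutativeMonoid.Sum (CommutativeRing.+-commutativeMonoid xor-∧-commutativeRing)
  using (∑-distrib-+; sum-init-last; sum-cong-≗) renaming (sum to xorSum)
open import Data.Empty using (⊥-elim)
open import Data.Fin using (Fin; zero; suc; inject₁; fromℕ; #_)
open import Data.Fin.Properties using (all?; _≟_)
open import Data.Fin.Subset using (Subset; inside; outside; ∣_∣; ∁; _∪_; _∩_; _∈_; _∉_; _⊆_; ⋃)
open import Data.Fin.Subset.Properties
  using (∣∁p∣≡n∸∣p∣; ∣p∣≤n; ∩-distribˡ-∪; ∩-comm; x∉p⇒x∈∁p; x∈p∪q⁻; x∈p∩q⁻; p⊆q⇒∣p∣≤∣q∣; ∣⊥∣≡0; p⊆p∪q; q⊆p∪q; _∈?_)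
open import Data.Integer using (+_; _⊖_) renaming (_≤_ to _≤ℤ_; _+_ to _+ℤ_; _-_ to _-ℤ_)
import Data.Integer.Properties as ℤ
open import Data.List using (tabulate)
open import Data.Nat using (ℕ; zero; suc; _+_; _*_; _∸_; _%_; _≤_)
import Data.Nat.Properties as ℕ
open import Data.Nat.Properties
  using (+-suc; +-assoc; +-comm; *-assoc; m≤m+n; m≤n+m; m+[n∸m]≡n; m+n∸n≡m; ≤-trans; ≤-reflexive; +-monoʳ-≤; +-monoˡ-≤; +-mono-≤; module ≤-Reasoning)
open import Data.Nat.DivMod using (%-distribˡ-+)
open import Data.Nat.Tactic.RingSolver using (solve-∀)
open import Data.Product using (Σ-syntax; _×_; _,_; proj₁; proj₂)
open import Data.Product.Properties using (≡-dec)
open import Data.Sum using (inj₁; inj₂; [_,_]′)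
open import Data.Sum.Properties using (inj₁-injective)
open import Data.Vec using (Vec; []; _∷_; lookup)
open import Data.Vec.Functional using (tail)
open import Data.Vec.Relation.Unary.All using (All; []; _∷_)
open import Data.Vec.Relation.Unary.All.Properties using (lookup⁺)
open import Data.Vec.Relation.Unary.AllPairs using (allPairs?)
open import Data.Vec.Relation.Unary.Unique.Propositional using (Unique)
open import Data.Vec.Relation.Unary.Unique.Propositional.Properties using (lookup-injective)
open import Function using (_∘_; const)
open import Function.Bundles using (mk↣)
open import Function.Definitions using (Injective; StrictlyInverseʳ)
open import Function.Consequences.Propositional using (inverseʳ⇒injective; strictlyInverseʳ⇒inverseʳ)
open import Relation.Binary.Definitions using (DecidableEquality)
open import Relation.Binary.PropositionalEquality
open import Relation.Nullary using (¬_; Dec; yes; no; does; ¬?; _×-dec_; _⊎-dec_)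
open import Relation.Nullary.Decidable using (True; toWitness)
open import Relation.Unary using (Decidable)

∣p∪q∣+∣p∩q∣≡∣p∣+∣q∣ : ∀ {n} (p q : Subset n) → ∣ p ∪ q ∣ + ∣ p ∩ q ∣ ≡ ∣ p ∣ + ∣ q ∣
∣p∪q∣+∣p∩q∣≡∣p∣+∣q∣ [] [] = refl
∣p∪q∣+∣p∩q∣≡∣p∣+∣q∣ (outside ∷ p) (outside ∷ q) = ∣p∪q∣+∣p∩q∣≡∣p∣+∣q∣ p q
∣p∪q∣+∣p∩q∣≡∣p∣+∣q∣ (inside ∷ p) (outside ∷ q) = cong suc (∣p∪q∣+∣p∩q∣≡∣p∣+∣q∣ p q)
∣p∪q∣+∣p∩q∣≡∣p∣+∣q∣ (outside ∷ p) (inside ∷ q) =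
  trans (cong suc (∣p∪q∣+∣p∩q∣≡∣p∣+∣q∣ p q)) (sym (+-suc (∣ p ∣) (∣ q ∣)))
∣p∪q∣+∣p∩q∣≡∣p∣+∣q∣ (inside ∷ p) (inside ∷ q) =
  cong suc (trans (+-suc (∣ p ∪ q ∣) (∣ p ∩ q ∣))
                  (trans (cong suc (∣p∪q∣+∣p∩q∣≡∣p∣+∣q∣ p q)) (sym (+-suc (∣ p ∣) (∣ q ∣)))))

∣p∪q∣≤∣p∣+∣q∣ : ∀ {n} (p q : Subset n) → ∣ p ∪ q ∣ ≤ ∣ p ∣ + ∣ q ∣
∣p∪q∣≤∣p∣+∣q∣ p q = ≤-trans (m≤m+n _ _) (≤-reflexive (∣p∪q∣+∣p∩q∣≡∣p∣+∣q∣ p q))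

∣p∣+∣∁p∣≡n : ∀ {n} (p : Subset n) → ∣ p ∣ + ∣ ∁ p ∣ ≡ n
∣p∣+∣∁p∣≡n p = trans (cong (λ s → ∣ p ∣ + s) (∣∁p∣≡n∸∣p∣ p)) (m+[n∸m]≡n (∣p∣≤n p))

∣p∣+∣q∣+∣r∣≤∣p∪q∪r∣+∣p∩q∣+∣q∩r∣+∣r∩p∣ : ∀ {n} (p q r : Subset n) →
  ∣ p ∣ + ∣ q ∣ + ∣ r ∣ ≤ ∣ p ∪ q ∪ r ∣ + (∣ p ∩ q ∣ + ∣ q ∩ r ∣ + ∣ r ∩ p ∣)
∣p∣+∣q∣+∣r∣≤∣p∪q∪r∣+∣p∩q∣+∣q∩r∣+∣r∩p∣ {n} p q r = begin
  ∣ p ∣ + ∣ q ∣ + ∣ r ∣                      ≡⟨ +-assoc (∣ p ∣) _ _ ⟩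
  ∣ p ∣ + (∣ q ∣ + ∣ r ∣)                    ≡⟨ cong (λ s → ∣ p ∣ + s) (∣p∪q∣+∣p∩q∣≡∣p∣+∣q∣ q r) ⟨
  ∣ p ∣ + (∣ q ∪ r ∣ + ∣ q ∩ r ∣)            ≡⟨ +-assoc (∣ p ∣) _ _ ⟨
  ∣ p ∣ + ∣ q ∪ r ∣ + ∣ q ∩ r ∣              ≡⟨ cong (_+ ∣ q ∩ r ∣) (∣p∪q∣+∣p∩q∣≡∣p∣+∣q∣ p (q ∪ r)) ⟨
  ∣ X ∣ + ∣ p ∩ (q ∪ r) ∣ + ∣ q ∩ r ∣        ≡⟨ cong (λ s → ∣ X ∣ + ∣ s ∣ + ∣ q ∩ r ∣) (∩-distribˡ-∪ p q r) ⟩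
  ∣ X ∣ + ∣ p ∩ q ∪ p ∩ r ∣ + ∣ q ∩ r ∣      ≤⟨ +-monoˡ-≤ (∣ q ∩ r ∣) (+-monoʳ-≤ (∣ X ∣) (∣p∪q∣≤∣p∣+∣q∣ (p ∩ q) (p ∩ r))) ⟩
  ∣ X ∣ + (∣ p ∩ q ∣ + ∣ p ∩ r ∣) + ∣ q ∩ r ∣ ≡⟨ cong (λ s → ∣ X ∣ + (∣ p ∩ q ∣ + ∣ s ∣) + ∣ q ∩ r ∣) (∩-comm p r) ⟩
  ∣ X ∣ + (∣ p ∩ q ∣ + ∣ r ∩ p ∣) + ∣ q ∩ r ∣ ≡⟨ shuffle (∣ X ∣) (∣ p ∩ q ∣) (∣ r ∩ p ∣) (∣ q ∩ r ∣) ⟩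
  ∣ X ∣ + (∣ p ∩ q ∣ + ∣ q ∩ r ∣ + ∣ r ∩ p ∣) ∎
  where
  open ≤-Reasoning
  X : Subset n
  X = p ∪ q ∪ r
  shuffle : ∀ a b c d → a + (b + c) + d ≡ a + (b + d + c)
  shuffle = solve-∀

∣∁[p∪q∪r]∣+∣p∣+∣q∣+∣r∣≤n+∣p∩q∣+∣q∩r∣+∣r∩p∣ : ∀ {n} (p q r : Subset n) →
  ∣ ∁ (p ∪ q ∪ r) ∣ + (∣ p ∣ + ∣ q ∣ + ∣ r ∣) ≤ n + (∣ p ∩ q ∣ + ∣ q ∩ r ∣ + ∣ r ∩ p ∣)
∣∁[p∪q∪r]∣+∣p∣+∣q∣+∣r∣≤n+∣p∩q∣+∣q∩r∣+∣r∩p∣ {n} p q r = begin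
  ∣ ∁ X ∣ + (∣ p ∣ + ∣ q ∣ + ∣ r ∣)  ≤⟨ +-monoʳ-≤ (∣ ∁ X ∣) (∣p∣+∣q∣+∣r∣≤∣p∪q∪r∣+∣p∩q∣+∣q∩r∣+∣r∩p∣ p q r) ⟩
  ∣ ∁ X ∣ + (∣ X ∣ + shared)           ≡⟨ +-assoc (∣ ∁ X ∣) (∣ X ∣) shared ⟨
  ∣ ∁ X ∣ + ∣ X ∣ + shared             ≡⟨ cong (_+ shared) (trans (+-comm (∣ ∁ X ∣) (∣ X ∣)) (∣p∣+∣∁p∣≡n X)) ⟩
  n + shared                           ∎
  where
  open ≤-Reasoning
  X : Subset n
  X = p ∪ q ∪ r
  shared : ℕ
  shared = ∣ p ∩ q ∣ + ∣ q ∩ r ∣ + ∣ r ∩ p ∣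

∣⋃f∣≤l*m : ∀ {n l m} (f : Fin l → Subset n) → (∀ j → ∣ f j ∣ ≤ m) → ∣ ⋃ (tabulate f) ∣ ≤ l * m
∣⋃f∣≤l*m {n} {zero}  f bound = ≤-reflexive (∣⊥∣≡0 n)
∣⋃f∣≤l*m {l = suc l} f bound =
  ≤-trans (∣p∪q∣≤∣p∣+∣q∣ (f zero) _) (+-mono-≤ (bound zero) (∣⋃f∣≤l*m (f ∘ suc) (bound ∘ suc)))

f[j]⊆⋃f : ∀ {n l} (f : Fin l → Subset n) j → f j ⊆ ⋃ (tabulate f)
f[j]⊆⋃f f zero    = p⊆p∪q _
f[j]⊆⋃f f (suc j) = q⊆p∪q (f zero) _ ∘ f[j]⊆⋃f (f ∘ suc) j

x∉p,q,r⇒x∈∁[p∪q∪r] : ∀ {n x} {p q r : Subset n} → x ∉ p → x ∉ q → x ∉ r → x ∈ ∁ (p ∪ q ∪ r)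
x∉p,q,r⇒x∈∁[p∪q∪r] {p = p} {q} {r} x∉p x∉q x∉r =
  x∉p⇒x∈∁p ([ x∉p , [ x∉q , x∉r ]′ ∘ x∈p∪q⁻ q r ]′ ∘ x∈p∪q⁻ p (q ∪ r))

ℕ-bound⇒ℤ-bound : ∀ {x y P Z} → x + y ≤ P + Z → + x ≤ℤ (+ P -ℤ + y) +ℤ + Z
ℕ-bound⇒ℤ-bound {x} {y} {P} {Z} h = begin
  + x                    ≡⟨ cong +_ (m+n∸n≡m x y) ⟨
  + (x + y ∸ y)          ≡⟨ ℤ.⊖-≥ (m≤n+m y x) ⟨
  (x + y) ⊖ y            ≤⟨ ℤ.⊖-monoˡ-≤ y h ⟩
  (P + Z) ⊖ y            ≡⟨ ℤ.distribˡ-⊖-+-pos Z P y ⟨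
  P ⊖ y +ℤ + Z           ≡⟨ cong (_+ℤ + Z) (ℤ.[+m]-[+n]≡m⊖n P y) ⟨
  (+ P -ℤ + y) +ℤ + Z    ∎
  where open ℤ.≤-Reasoning

cyclicSuc : ∀ {n} → Fin (suc n) → Fin (suc n)
cyclicSuc {zero}  zero    = zero
cyclicSuc {suc n} zero    = suc zero
cyclicSuc {suc n} (suc i) with cyclicSuc i
... | zero  = zero
... | suc j = suc (suc j)

cyclicSuc-inject₁ : ∀ {n} (i : Fin n) → cyclicSuc (inject₁ i) ≡ suc i
cyclicSuc-inject₁ {suc n} zero = refl
cyclicSuc-inject₁ {suc n} (suc i) rewrite cyclicSuc-inject₁ i = refl

cyclicSuc-fromℕ : ∀ n → cyclicSuc (fromℕ n) ≡ zero
cyclicSuc-fromℕ zero = refl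
cyclicSuc-fromℕ (suc n) rewrite cyclicSuc-fromℕ n = refl

xorSum-cyclicSuc : ∀ {n} (g : Fin (suc n) → Bool) → xorSum (g ∘ cyclicSuc) ≡ xorSum g
xorSum-cyclicSuc {n} g = begin
  xorSum (g ∘ cyclicSuc)                                        ≡⟨ sum-init-last (g ∘ cyclicSuc) ⟩
  xorSum (g ∘ cyclicSuc ∘ inject₁) xor g (cyclicSuc (fromℕ n))  ≡⟨ cong₂ _xor_ (sum-cong-≗ (cong g ∘ cyclicSuc-inject₁))
                                                                                 (cong g (cyclicSuc-fromℕ n)) ⟩
  xorSum (tail g) xor g zero                                    ≡⟨ xor-comm (xorSum (tail g)) (g zero) ⟩
  xorSum g                                                      ∎
  where open ≡-Reasoning

switchedSigns : ∀ {n} → (Fin (suc n) → Bool) → (Fin (suc n) → Bool) → Fin (suc n) → Bool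
switchedSigns s g i = (s i xor g i) xor g (cyclicSuc i)

xorSum-switchedSigns : ∀ {n} (s g : Fin (suc n) → Bool) → xorSum (switchedSigns s g) ≡ xorSum s
xorSum-switchedSigns s g = begin
  xorSum (switchedSigns s g)                             ≡⟨ ∑-distrib-+ (λ i → s i xor g i) (g ∘ cyclicSuc) ⟩
  xorSum (λ i → s i xor g i) xor xorSum (g ∘ cyclicSuc)  ≡⟨ cong₂ _xor_ (∑-distrib-+ s g) (xorSum-cyclicSuc g) ⟩
  (xorSum s xor xorSum g) xor xorSum g                   ≡⟨ xor-assoc (xorSum s) (xorSum g) (xorSum g) ⟩
  xorSum s xor (xorSum g xor xorSum g)                   ≡⟨ cong (xorSum s xor_) (xor-same (xorSum g)) ⟩
  xorSum s xor false                                     ≡⟨ xor-identityʳ (xorSum s) ⟩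
  xorSum s                                               ∎
  where open ≡-Reasoning

countTrue%2≡xorSum : ∀ {n} (f : Fin n → Bool) → countTrue f % 2 ≡ (if xorSum f then 1 else 0)
countTrue%2≡xorSum {zero}  f = refl
countTrue%2≡xorSum {suc n} f with f zero
... | false = countTrue%2≡xorSum (tail f)
... | true  = begin
  suc (countTrue (tail f)) % 2                ≡⟨ %-distribˡ-+ 1 (countTrue (tail f)) 2 ⟩
  suc (countTrue (tail f) % 2) % 2            ≡⟨ cong (λ r → suc r % 2) (countTrue%2≡xorSum (tail f)) ⟩
  suc (if xorSum (tail f) then 1 else 0) % 2  ≡⟨ flip (xorSum (tail f)) ⟩
  (if not (xorSum (tail f)) then 1 else 0)    ∎
  where
  open ≡-Reasoning
  flip : ∀ b → suc (if b then 1 else 0) % 2 ≡ (if not b then 1 else 0)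
  flip true  = refl
  flip false = refl

switchedSigns-parity : ∀ {n} (s g : Fin (suc n) → Bool) → countTrue (switchedSigns s g) % 2 ≡ countTrue s % 2
switchedSigns-parity s g = begin
  countTrue (switchedSigns s g) % 2              ≡⟨ countTrue%2≡xorSum (switchedSigns s g) ⟩
  (if xorSum (switchedSigns s g) then 1 else 0)  ≡⟨ cong (λ b → if b then 1 else 0) (xorSum-switchedSigns s g) ⟩
  (if xorSum s then 1 else 0)                    ≡⟨ countTrue%2≡xorSum s ⟨
  countTrue s % 2                                ∎
  where open ≡-Reasoning

record SwitchingEmbedding (G H : SignedGraph) : Set where
  private
    module G = SignedGraph G
    module H = SignedGraph H
  field
    map       : G.V → H.V
    injective : Injective _≡_ _≡_ map
    switching : G.V → Bool
    edge      : ∀ {a b s} → G.Edge a b s → H.Edge (map a) (map b) ((s xor switching a) xor switching b)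

module _ {G H : SignedGraph} (e : SwitchingEmbedding G H) where
  open SwitchingEmbedding e
  open SignedGraph H using (Edge)

  mapCycle : ∀ {P} → CycleIn G (P ∘ map) → CycleIn H P
  mapCycle C = record
    { len      = len
    ; vtx      = map ∘ vtx
    ; sgn      = switchedSigns sgn (switching ∘ vtx)
    ; distinct = distinct ∘ injective
    ; inX      = inX
    ; step     = λ i → switchedEdge (inject₁ i) (sym (cyclicSuc-inject₁ i)) (edge (step i))
    ; close    = switchedEdge (fromℕ _) (sym (cyclicSuc-fromℕ _)) (edge close)
    }
    where
    open CycleIn C
    switchedEdge : ∀ {a b} i {j} → j ≡ cyclicSuc i →
                   Edge a b ((sgn i xor switching (vtx i)) xor switching (vtx j)) →
                   Edge a b (switchedSigns sgn (switching ∘ vtx) i)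
    switchedEdge i refl e = e

  mapCycle-negative : ∀ {P} (C : CycleIn G (P ∘ map)) → NegativeCycle G C → NegativeCycle H (mapCycle {P} C)
  mapCycle-negative C = trans (switchedSigns-parity (CycleIn.sgn C) (switching ∘ CycleIn.vtx C))

  Balanced-pullback : ∀ {P} → Balanced H P → Balanced G (P ∘ map)
  Balanced-pullback {P} balanced (C , negative) = balanced (mapCycle {P} C , mapCycle-negative {P} C negative)

module _ (G : SignedGraph) where
  open SignedGraph G

  cycleThrough : ∀ {n X} (vs : Vec V (3 + n)) (sgn : Fin (3 + n) → Bool) → Unique vs →
                 (∀ i → Edge (lookup vs i) (lookup vs (cyclicSuc i)) (sgn i)) → All X vs → CycleIn G X
  cycleThrough vs sgn unique edge all = record
    { len      = _
    ; vtx      = lookup vs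
    ; sgn      = sgn
    ; distinct = lookup-injective unique _ _
    ; inX      = lookup⁺ all
    ; step     = λ i → subst (λ j → Edge (lookup vs (inject₁ i)) (lookup vs j) (sgn (inject₁ i)))
                              (cyclicSuc-inject₁ i) (edge (inject₁ i))
    ; close    = subst (λ j → Edge (lookup vs (fromℕ _)) (lookup vs j) (sgn (fromℕ _)))
                       (cyclicSuc-fromℕ _) (edge (fromℕ _))
    }

code : WV → ℕ
code vu      = 0
code vv      = 1
code (ι vw)  = 2
code (ι vz)  = 3
code (ι vt)  = 4
code (ι vx1) = 5
code (ι vx2) = 6
code (ι vx3) = 7
code (ι vx4) = 8
code (ι vx5) = 9
code (ι va1) = 10
code (ι va2) = 11
code (ι va3) = 12
code (ι vb1) = 13
code (ι vb2) = 14
code (ι vb3) = 15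

decode : ℕ → WV
decode 0  = vu
decode 1  = vv
decode 2  = ι vw
decode 3  = ι vz
decode 4  = ι vt
decode 5  = ι vx1
decode 6  = ι vx2
decode 7  = ι vx3
decode 8  = ι vx4
decode 9  = ι vx5
decode 10 = ι va1
decode 11 = ι va2
decode 12 = ι va3
decode 13 = ι vb1
decode 14 = ι vb2
decode _  = ι vb3

decode-code : StrictlyInverseʳ _≡_ code decode
decode-code = λ
  { vu → refl ; vv → refl ; (ι vw) → refl ; (ι vz) → refl ; (ι vt) → refl ; (ι vx1) → refl
  ; (ι vx2) → refl ; (ι vx3) → refl ; (ι vx4) → refl ; (ι vx5) → refl ; (ι va1) → refl
  ; (ι va2) → refl ; (ι va3) → refl ; (ι vb1) → refl ; (ι vb2) → refl ; (ι vb3) → refl }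

_≟ᵥ_ : DecidableEquality WV
_≟ᵥ_ = ℕ.eq? (mk↣ (inverseʳ⇒injective code (strictlyInverseʳ⇒inverseʳ {f⁻¹ = decode} code decode-code)))

open import Data.List.Membership.DecPropositional (≡-dec _≟ᵥ_ (≡-dec _≟ᵥ_ Bool._≟_))
  using () renaming (_∈?_ to _∈ₗ?_)

W'Edge? : ∀ a b s → Dec (W'Edge a b s)
W'Edge? a b s = ((a , b , s) ∈ₗ? W'edges) ⊎-dec ((b , a , s) ∈ₗ? W'edges)

W' : SignedGraph
W' = record { V = WV ; Edge = W'Edge }

isNegativeEdge : WV → WV → Bool
isNegativeEdge a b = does (W'Edge? a b true)

cycleSigns : ∀ {n} → Vec WV (suc n) → Fin (suc n) → Bool
cycleSigns vs i = isNegativeEdge (lookup vs i) (lookup vs (cyclicSuc i))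

IsNegativeCycle : ∀ {n} → Vec WV (3 + n) → Set
IsNegativeCycle vs = Unique vs
                   × (∀ i → W'Edge (lookup vs i) (lookup vs (cyclicSuc i)) (cycleSigns vs i))
                   × countTrue (cycleSigns vs) % 2 ≡ 1

isNegativeCycle? : ∀ {n} (vs : Vec WV (3 + n)) → Dec (IsNegativeCycle vs)
isNegativeCycle? vs = allPairs? (λ a b → ¬? (a ≟ᵥ b)) vs
                ×-dec all? (λ i → W'Edge? _ _ _)
                ×-dec countTrue (cycleSigns vs) % 2 ℕ.≟ 1

Misses : (WV → Set) → WV × WV × WV → Set
Misses S (a , b , c) = ¬ S a × ¬ S b × ¬ S c

module _ {S : WV → Set} (balanced : Balanced W' S) where

  -- The implicit argument is found by evaluation, which checks that vs is a negative cycle of W'.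
  notAllIn : ∀ {n} (vs : Vec WV (3 + n)) {isNegative : True (isNegativeCycle? vs)} → ¬ All S vs
  notAllIn vs {isNegative} allIn =
    let unique , edges , odd = toWitness isNegative
    in  balanced (cycleThrough W' vs (cycleSigns vs) unique edges allIn , odd)

  -- z and t miss S, and the negative cycles u x₂ x₃ v and u x₅ x₄ v leave exactly one of x₂, x₃
  -- and one of x₄, x₅ in S unless the triangle z x₂ x₃ or t x₄ x₅ misses S. Each of the four
  -- remaining cases is settled by at most four more short negative cycles.
  someTriangleMisses : Decidable S → S vu → S vv → Σ[ j ∈ Fin 7 ] Misses S (lookup triangles j)
  someTriangleMisses S? u∈ v∈ with S? (ι vx2) | S? (ι vx3) | S? (ι vx4) | S? (ι vx5)
  ... | no x₂∉  | no x₃∉  | _       | _       =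
    # 3 , (λ z∈ → notAllIn (vu ∷ vv ∷ ι vz ∷ []) (u∈ ∷ v∈ ∷ z∈ ∷ [])) , x₂∉ , x₃∉
  ... | yes x₂∈ | yes x₃∈ | _       | _       =
    ⊥-elim (notAllIn (vu ∷ ι vx2 ∷ ι vx3 ∷ vv ∷ []) (u∈ ∷ x₂∈ ∷ x₃∈ ∷ v∈ ∷ []))
  ... | _       | _       | no x₄∉  | no x₅∉  =
    # 4 , (λ t∈ → notAllIn (vu ∷ vv ∷ ι vt ∷ []) (u∈ ∷ v∈ ∷ t∈ ∷ [])) , x₄∉ , x₅∉
  ... | _       | _       | yes x₄∈ | yes x₅∈ =
    ⊥-elim (notAllIn (vu ∷ ι vx5 ∷ ι vx4 ∷ vv ∷ []) (u∈ ∷ x₅∈ ∷ x₄∈ ∷ v∈ ∷ []))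
  ... | yes x₂∈ | no x₃∉  | yes x₄∈ | no x₅∉  with S? (ι vx1)
  ...   | no x₁∉  = # 1 , w∉ , x₁∉ , x₅∉
    where
    w∉ : ¬ S (ι vw)
    w∉ w∈ = notAllIn (vu ∷ ι vx2 ∷ ι vw ∷ ι vx4 ∷ vv ∷ []) (u∈ ∷ x₂∈ ∷ w∈ ∷ x₄∈ ∷ v∈ ∷ [])
  ...   | yes x₁∈ = # 5 , (λ a₁∈ → notAllIn (ι va1 ∷ ι vx1 ∷ ι vx2 ∷ []) (a₁∈ ∷ x₁∈ ∷ x₂∈ ∷ []))
                     , (λ a₂∈ → notAllIn (ι va2 ∷ vu ∷ ι vx2 ∷ []) (a₂∈ ∷ u∈ ∷ x₂∈ ∷ []))
                     , (λ a₃∈ → notAllIn (ι va3 ∷ vu ∷ ι vx1 ∷ []) (a₃∈ ∷ u∈ ∷ x₁∈ ∷ []))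
  someTriangleMisses S? u∈ v∈ | yes x₂∈ | no x₃∉ | no x₄∉ | yes x₅∈ with S? (ι vw)
  ...   | no w∉  = # 2 , w∉ , x₃∉ , x₄∉
  ...   | yes w∈ = ⊥-elim (notAllIn (vu ∷ ι vx2 ∷ ι vw ∷ ι vx5 ∷ []) (u∈ ∷ x₂∈ ∷ w∈ ∷ x₅∈ ∷ []))
  someTriangleMisses S? u∈ v∈ | no x₂∉ | yes x₃∈ | yes x₄∈ | no x₅∉ =
    # 6 , (λ b₁∈ → notAllIn (ι vb1 ∷ ι vx3 ∷ ι vx4 ∷ []) (b₁∈ ∷ x₃∈ ∷ x₄∈ ∷ []))
      , (λ b₂∈ → notAllIn (ι vb2 ∷ vv ∷ ι vx4 ∷ []) (b₂∈ ∷ v∈ ∷ x₄∈ ∷ []))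
      , (λ b₃∈ → notAllIn (ι vb3 ∷ vv ∷ ι vx3 ∷ []) (b₃∈ ∷ v∈ ∷ x₃∈ ∷ []))
  someTriangleMisses S? u∈ v∈ | no x₂∉ | yes x₃∈ | no x₄∉ | yes x₅∈ with S? (ι vw)
  ...   | no w∉  = # 0 , w∉ , x₁∉ , x₂∉
    where
    x₁∉ : ¬ S (ι vx1)
    x₁∉ x₁∈ = notAllIn (vu ∷ ι vx1 ∷ ι vx5 ∷ []) (u∈ ∷ x₁∈ ∷ x₅∈ ∷ [])
  ...   | yes w∈ = ⊥-elim (notAllIn (vu ∷ ι vx5 ∷ ι vw ∷ ι vx3 ∷ vv ∷ []) (u∈ ∷ x₅∈ ∷ w∈ ∷ x₃∈ ∷ v∈ ∷ []))

unembW : ∀ {k} → Fin 3 → GV k → W*V k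
unembW i (inj₁ y)             = inj₁ (if does (y ≟ i) then vu else vv)
unembW i (inj₂ (_ , inj₁ a)) = inj₁ (ι a)
unembW i (inj₂ (_ , inj₂ r)) = inj₂ r

unembW-embW : ∀ {k} i → StrictlyInverseʳ _≡_ (embW {k} i) (unembW i)
unembW-embW zero             (inj₁ vu)    = refl
unembW-embW (suc zero)       (inj₁ vu)    = refl
unembW-embW (suc (suc zero)) (inj₁ vu)    = refl
unembW-embW zero             (inj₁ vv)    = refl
unembW-embW (suc zero)       (inj₁ vv)    = refl
unembW-embW (suc (suc zero)) (inj₁ vv)    = refl
unembW-embW i                (inj₁ (ι a)) = refl
unembW-embW i                (inj₂ r)     = refl

embW-injective : ∀ {k} i → Injective _≡_ _≡_ (embW {k} i)
embW-injective i =
  inverseʳ⇒injective (embW i) (strictlyInverseʳ⇒inverseʳ {f⁻¹ = unembW i} (embW i) (unembW-embW i))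

position : ∀ {k} → Fin 7 → W*V k → Fin (3 + k)
position j (inj₁ w)      = let (a , b , _) = lookup triangles j in
                           if does (w ≟ᵥ a) then t0 else if does (w ≟ᵥ b) then t1 else t2
position j (inj₂ (_ , r)) = suc (suc (suc r))

position-embT : ∀ {k} j → StrictlyInverseʳ _≡_ (embT {k} j) (position j)
position-embT {k} j zero                = toWitness {a? = all? (λ j → position j (embT {k} j t0) ≟ t0)} _ j
position-embT {k} j (suc zero)          = toWitness {a? = all? (λ j → position j (embT {k} j t1) ≟ t1)} _ j
position-embT {k} j (suc (suc zero))    = toWitness {a? = all? (λ j → position j (embT {k} j t2) ≟ t2)} _ j
position-embT     j (suc (suc (suc r))) = refl

embT-injective : ∀ {k} j → Injective _≡_ _≡_ (embT {k} j)
embT-injective j =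
  inverseʳ⇒injective (embT j) (strictlyInverseʳ⇒inverseʳ {f⁻¹ = position j} (embT j) (position-embT j))

module _ {k} (T : OuterTriangleGraph k) where
  open OuterTriangleGraph T using (asSigned; σ)

  W'↪G* : Fin 3 → SwitchingEmbedding W' (G* T)
  W'↪G* i = record
    { map       = embW i ∘ inj₁
    ; injective = inj₁-injective ∘ embW-injective i
    ; switching = const false
    ; edge      = λ {a} {b} {s} ab → subst (G*Edge T _ _) (sym (unswitched s))
                                           (inj₂ (i , _ , _ , inj₁ (a , b , ab , refl , refl) , refl , refl))
    }
    where
    unswitched : ∀ s → (s xor false) xor false ≡ s
    unswitched s = trans (xor-identityʳ (s xor false)) (xor-identityʳ s)

  T↪G* : Fin 3 → Fin 7 → SwitchingEmbedding asSigned (G* T)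
  T↪G* i j = record
    { map       = embW i ∘ embT j
    ; injective = embT-injective j ∘ embW-injective i
    ; switching = σ
    ; edge      = λ {a} {b} → λ { (ab , refl) →
                    inj₂ (i , _ , _ , inj₂ (j , a , b , ab , refl , refl , refl) , refl , refl) }
    }

module _ {k} (T : OuterTriangleGraph k) {p q} (c : GV k → Subset p)
         (coloring : BalancedColoring (G* T) p q c) where
  open OuterTriangleGraph T using (asSigned)

  missingCopy : Fin 3 → Fin 7 → Subset p
  missingCopy i j = ∁ (c (embW i (embT j t0)) ∪ c (embW i (embT j t1)) ∪ c (embW i (embT j t2)))

  missingSomeCopy : Fin 3 → Subset p
  missingSomeCopy i = ⋃ (tabulate (missingCopy i))

  copyColoring : ∀ i j → BalancedColoring asSigned p q (c ∘ embW i ∘ embT j)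
  copyColoring i j = proj₁ coloring ∘ embW i ∘ embT j
                   , λ α → Balanced-pullback (T↪G* T i j) (proj₂ coloring α)

  shared⊆missingSomeCopy : ∀ i → c (inj₁ i) ∩ c (inj₁ (nxt i)) ⊆ missingSomeCopy i
  shared⊆missingSomeCopy i {α} α∈shared with x∈p∩q⁻ (c (inj₁ i)) _ α∈shared
  ... | α∈yᵢ , α∈yᵢ₊₁ with someTriangleMisses (Balanced-pullback (W'↪G* T i) (proj₂ coloring α))
                                              (λ x → α ∈? c (embW i (inj₁ x))) α∈yᵢ α∈yᵢ₊₁
  ... | j , a∉ , b∉ , d∉ = f[j]⊆⋃f (missingCopy i) j (x∉p,q,r⇒x∈∁[p∪q∪r] a∉ b∉ d∉)

  ∣shared∣≤7m : ∀ {m} → (∀ c′ → BalancedColoring asSigned p q c′ → missing c′ t0 t1 t2 ≤ m) →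
                ∀ i → ∣ c (inj₁ i) ∩ c (inj₁ (nxt i)) ∣ ≤ 7 * m
  ∣shared∣≤7m missing≤m i = ≤-trans (p⊆q⇒∣p∣≤∣q∣ (shared⊆missingSomeCopy i))
                                    (∣⋃f∣≤l*m (missingCopy i) (λ j → missing≤m _ (copyColoring i j)))

lemma6 : (p q : ℕ) → 2 * q ≤ p → 2 * p ≤ 5 * q →
    (k : ℕ) (T : OuterTriangleGraph k) (m : ℕ) →
    ((c : Fin (3 + k) → Subset p) → BalancedColoring (OuterTriangleGraph.asSigned T) p q c → missing c t0 t1 t2 ≤ m) →
    (c : GV k → Subset p) → BalancedColoring (G* T) p q c →
    + missing c y₀ y₁ y₂ ≤ℤ (+ p -ℤ + (3 * q)) +ℤ + (21 * m)
lemma6 p q _ _ k T m missing≤m c coloring = ℕ-bound⇒ℤ-bound (begin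
  missing c y₀ y₁ y₂ + 3 * q
    ≡⟨ cong (λ s → missing c y₀ y₁ y₂ + s) sizes ⟨
  missing c y₀ y₁ y₂ + (∣ c y₀ ∣ + ∣ c y₁ ∣ + ∣ c y₂ ∣)
    ≤⟨ ∣∁[p∪q∪r]∣+∣p∣+∣q∣+∣r∣≤n+∣p∩q∣+∣q∩r∣+∣r∩p∣ (c y₀) (c y₁) (c y₂) ⟩
  p + (∣ c y₀ ∩ c y₁ ∣ + ∣ c y₁ ∩ c y₂ ∣ + ∣ c y₂ ∩ c y₀ ∣)
    ≤⟨ +-monoʳ-≤ p (+-mono-≤ (+-mono-≤ (shared≤7m (# 0)) (shared≤7m (# 1))) (shared≤7m (# 2))) ⟩
  p + (7 * m + 7 * m + 7 * m)
    ≡⟨ cong (λ s → p + s) (trans (triple (7 * m)) (sym (*-assoc 3 7 m))) ⟩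
  p + 21 * m
    ∎)
  where
  open ≤-Reasoning
  shared≤7m : ∀ i → ∣ c (inj₁ i) ∩ c (inj₁ (nxt i)) ∣ ≤ 7 * m
  shared≤7m = ∣shared∣≤7m T c coloring missing≤m
  triple : ∀ n → n + n + n ≡ 3 * n
  triple = solve-∀
  sizes : ∣ c y₀ ∣ + ∣ c y₁ ∣ + ∣ c y₂ ∣ ≡ 3 * q
  sizes = trans (cong₂ _+_ (cong₂ _+_ (proj₁ coloring y₀) (proj₁ coloring y₁)) (proj₁ coloring y₂)) (triple q)
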